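{- Let $G$ be a mixed unit interval graph and $\mathcal{B}$ a $\mathcal{U}$-bubble model for $G$. Then $\varphi_{\mathcal{B}}(G)\le\omega(G)-1$, where $\omega(G)$ is the maximum size of a clique of $G$.
   Context: A mixed unit interval graph is an intersection graph of unit intervals, each closed, open or half-open. A 2-dimensional $\mathcal{U}$-bubble structure for a finite nonempty set $A$ is a family $\mathcal{B}=\langle B_{i,j}\rangle_{1\le j\le k,\,1\le i\le r_j}$ of pairwise disjoint (possibly empty) sets ("bubbles") with union $A$, each partitioned into quadrants $B_{i,j}=B^{++}_{i,j}\cup B^{+- }_{i,j}\cup B^{ -+}_{i,j}\cup B^{ -- }_{i,j}$; $B^{*+}_{i,j}=B^{++}_{i,j}\cup B^{ -+}_{i,j}$, $B^{+*}_{i,j}=B^{++}_{i,j}\cup B^{+- }_{i,j}$. Column $j$ consists of the bubbles with second index $j$; row $i$ of those with first index $i$. The graph $G(\mathcal{B})$ has vertex set $A$, and distinct $u,v$ are adjacent iff, for some ordering, $u\in B_{i,j}$, $v\in B_{i',j'}$ and: (a) $j=j'$; or (b) $j=j'-1$ and $i>i'$; or (c) $j=j'-1$, $i=i'$, $u\in B^{*+}_{i,j}$, $v\in B^{+*}_{i',j'}$. A $\mathcal{U}$-bubble model of $G$ is such a structure for $V(G)$ with $G\cong G(\mathcal{B})$, every row and column containing a nonempty bubble, $B_{r_j,j}\ne\emptyset$ for all $j$, and with $\mathrm{top}(j)=\min\{i:B_{i,j}\ne\emptyset\}$, $\mathrm{top}(1)=1$, $\mathrm{top}(j)\le \mathrm{top}(j+1)$.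 Groups: vertices of the same column $j$ belong to the same group if they have the same neighbours in column $j+1$. For $v\in B_{i,j}$, the group number $g_{\mathcal{B}}(v)$ is the maximum, over the two choices $A=B^{*+}_{i,j-1}\cup B^{+*}_{i,j}$ and $A=B_{i,j}$, of the number of groups in $N(v)\cap\bigl(\bigcup_{i'=i+1}^{r_{j-1}}B_{i',j-1}\cup\bigcup_{i'=1}^{i-1}B_{i',j}\cup A\bigr)$ (bubbles of a nonexistent column $0$ are empty). The group number of $G$ in $\mathcal{B}$ is $\varphi_{\mathcal{B}}(G)=\max_{v\in V(G)}g_{\mathcal{B}}(v)$. -}

module Defs where

open import Data.Nat using (ℕ; zero; suc; _≤_; _<_; _⊔_)
open import Data.Fin using (Fin)
open import Data.Fin.Subset using (Subset; _∈_; ∣_∣)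
open import Data.Bool using (Bool; true; false)
open import Data.Product using (_×_; Σ; ∃; _,_)
open import Data.Sum using (_⊎_)
open import Relation.Binary.PropositionalEquality using (_≡_; _≢_)
open import Function.Bundles using (_⇔_)

-- Indices are 1-based as in the paper: columns 1..k, rows of column j are 1..r j.
-- Each vertex v lies in bubble B_{row v, col v}, in quadrant (s₁ v, s₂ v),
-- where true = '+' and false = '-'.  So B^{ab}_{i,j} = { v | row v = i, col v = j,
-- s₁ v = a, s₂ v = b }.
record BubbleStructure (n : ℕ) : Set where
  field
    k        : ℕ
    r        : ℕ → ℕ
    col      : Fin n → ℕ
    row      : Fin n → ℕ
    s₁       : Fin n → Bool
    s₂       : Fin n → Bool
    col-low  : ∀ v → 1 ≤ col v
    col-high : ∀ v → col v ≤ k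
    row-low  : ∀ v → 1 ≤ row v
    row-high : ∀ v → row v ≤ r (col v)

module _ {n : ℕ} (B : BubbleStructure n) where
  open BubbleStructure B

  AdjRule : Fin n → Fin n → Set
  AdjRule u v =
      col u ≡ col v
    ⊎ (suc (col u) ≡ col v × row v < row u)
    ⊎ (suc (col u) ≡ col v × row u ≡ row v × s₂ u ≡ true × s₁ v ≡ true)

  Adj : Fin n → Fin n → Set
  Adj u v = u ≢ v × (AdjRule u v ⊎ AdjRule v u)

  -- U-bubble model conditions (G is taken to be G(B) itself)
  record IsUBubbleModel : Set where
    field
      columns-nonempty : ∀ j → 1 ≤ j → j ≤ k → ∃ λ v → col v ≡ j
      rows-nonempty    : ∀ i j → 1 ≤ j → j ≤ k → 1 ≤ i → i ≤ r j →
                         ∃ λ v → row v ≡ i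
      last-nonempty    : ∀ j → 1 ≤ j → j ≤ k → ∃ λ v → col v ≡ j × row v ≡ r j
      -- top(1) = 1 (rows are ≥ 1, so this says B_{1,1} ≠ ∅)
      top-one          : ∃ λ v → col v ≡ 1 × row v ≡ 1
      -- top(j) ≤ top(j+1), unfolded: every nonempty bubble of column j+1 is
      -- at or below the row of some nonempty bubble of column j
      top-mono         : ∀ j → 1 ≤ j → suc j ≤ k → ∀ v → col v ≡ suc j →
                         ∃ λ u → col u ≡ j × row u ≤ row v

  SameGroup : Fin n → Fin n → Set
  SameGroup u w = col u ≡ col w ×
    (∀ x → col x ≡ suc (col u) → (Adj u x ⇔ Adj w x))

  -- The number of groups meeting a set S is g: g is the maximum size of a set
  -- of vertices of S lying in pairwise distinct groups.
  IsGroupCount : (Fin n → Set) → ℕ → Set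
  IsGroupCount S g =
    (∃ λ (R : Subset n) → (∀ x → x ∈ R → S x) ×
        (∀ x y → x ∈ R → y ∈ R → x ≢ y → SameGroup x y → Data.Empty.⊥) × ∣ R ∣ ≡ g)
    × (∀ (R : Subset n) → (∀ x → x ∈ R → S x) →
        (∀ x y → x ∈ R → y ∈ R → x ≢ y → SameGroup x y → Data.Empty.⊥) → ∣ R ∣ ≤ g)
    where import Data.Empty

  -- the set A for the two choices: false ↦ B^{*+}_{i,j-1} ∪ B^{+*}_{i,j},
  -- true ↦ B_{i,j}, where v ∈ B_{i,j}
  InA : Bool → Fin n → Fin n → Set
  InA false v x = (suc (col x) ≡ col v × row x ≡ row v × s₂ x ≡ true)
                ⊎ (col x ≡ col v × row x ≡ row v × s₁ x ≡ true)
  InA true v x = col x ≡ col v × row x ≡ row v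

  -- N(v) ∩ ( ⋃_{i' > i} B_{i',j-1} ∪ ⋃_{i' < i} B_{i',j} ∪ A )
  -- (column 0 is empty automatically since all columns are ≥ 1)
  Region : Bool → Fin n → Fin n → Set
  Region c v x = Adj v x ×
    ((suc (col x) ≡ col v × row v < row x)
     ⊎ (col x ≡ col v × row x < row v)
     ⊎ InA c v x)

  IsVertexGroupNumber : Fin n → ℕ → Set
  IsVertexGroupNumber v g = Σ ℕ λ g₁ → Σ ℕ λ g₂ →
    IsGroupCount (Region false v) g₁ × IsGroupCount (Region true v) g₂ × g ≡ g₁ ⊔ g₂

  IsGroupNumber : ℕ → Set
  IsGroupNumber φ = (∃ λ v → IsVertexGroupNumber v φ) ×
    (∀ v g → IsVertexGroupNumber v g → g ≤ φ)

  IsClique : Subset n → Set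
  IsClique C = ∀ u v → u ∈ C → v ∈ C → u ≢ v → Adj u v

  IsCliqueNumber : ℕ → Set
  IsCliqueNumber w = (∃ λ C → IsClique C × ∣ C ∣ ≡ w) ×
    (∀ C → IsClique C → ∣ C ∣ ≤ w)

-- Every vertex of the region of v is a neighbour of v, and the region is itself
-- a clique: its part in column j − 1 lies strictly below row i (or in B^{*+}_{i,j−1},
-- when A is the first choice), its part in column j lies at or above row i (and in
-- B^{+*}_{i,j} on row i, for the first choice), so rule (b) or (c) joins the two
-- parts and rule (a) joins each part to itself. Hence any set of vertices of the
-- region in pairwise distinct groups, together with v, is a clique of G, and the
-- group number of v is at most ω(G) − 1.
module Submission where

open import Defs
open import Data.Nat using (ℕ; _≤_; _∸_; _<_; suc)
open import Data.Nat.Properties using (<-trans; ⊔-lub; ≤-trans; pred-mono-≤; suc-injective)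
open import Data.Bool using (Bool; true; false)
open import Data.Product using (_×_; _,_; proj₁)
open import Data.Sum using (_⊎_; inj₁; inj₂)
open import Data.Empty using (⊥-elim)
open import Data.Fin using (Fin)
open import Data.Fin.Subset using (Subset; _∈_; _∉_; ∣_∣; _∪_; ⁅_⁆)
open import Data.Fin.Subset.Properties
  using (p⊂q⇒∣p∣<∣q∣; x∈p∪q⁻; x∈p∪q⁺; p⊆p∪q; x∈⁅x⁆; x∈⁅y⁆⇒x≡y)
open import Relation.Binary.PropositionalEquality using (_≡_; _≢_; refl; sym; trans; subst)

∣p∣<∣p∪⁅x⁆∣ : ∀ {n} {x : Fin n} (p : Subset n) → x ∉ p → ∣ p ∣ < ∣ p ∪ ⁅ x ⁆ ∣
∣p∣<∣p∪⁅x⁆∣ {x = x} p x∉p =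
  p⊂q⇒∣p∣<∣q∣ (p⊆p∪q ⁅ x ⁆ , x , x∈p∪q⁺ (inj₂ (x∈⁅x⁆ x)) , x∉p)

module _ {n : ℕ} (B : BubbleStructure n) where
  open BubbleStructure B

  Adj-sym : ∀ {x y} → Adj B x y → Adj B y x
  Adj-sym (x≢y , inj₁ rule) = (λ y≡x → x≢y (sym y≡x)) , inj₂ rule
  Adj-sym (x≢y , inj₂ rule) = (λ y≡x → x≢y (sym y≡x)) , inj₁ rule

  IsClique-∪⁅⁆ : ∀ {C v} → IsClique B C → (∀ x → x ∈ C → Adj B v x) →
                 IsClique B (C ∪ ⁅ v ⁆)
  IsClique-∪⁅⁆ {C} {v} clique v~C x y x∈ y∈ x≢y
    with x∈p∪q⁻ C ⁅ v ⁆ x∈ | x∈p∪q⁻ C ⁅ v ⁆ y∈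
  ... | inj₁ x∈C | inj₁ y∈C = clique x y x∈C y∈C x≢y
  ... | inj₁ x∈C | inj₂ y∈v with x∈⁅y⁆⇒x≡y v y∈v
  ...   | refl = Adj-sym (v~C x x∈C)
  IsClique-∪⁅⁆ {C} {v} clique v~C x y x∈ y∈ x≢y | inj₂ x∈v | inj₁ y∈C
    with x∈⁅y⁆⇒x≡y v x∈v
  ... | refl = v~C y y∈C
  IsClique-∪⁅⁆ {C} {v} clique v~C x y x∈ y∈ x≢y | inj₂ x∈v | inj₂ y∈v =
    ⊥-elim (x≢y (trans (x∈⁅y⁆⇒x≡y v x∈v) (sym (x∈⁅y⁆⇒x≡y v y∈v))))

  cliqueInNeighbourhood-∣∣≤ω∸1 : ∀ {C v w} → IsClique B C → (∀ x → x ∈ C → Adj B v x) →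
                                 IsCliqueNumber B w → ∣ C ∣ ≤ w ∸ 1
  cliqueInNeighbourhood-∣∣≤ω∸1 {C} {v} clique v~C (_ , maximal) =
    pred-mono-≤ (≤-trans (∣p∣<∣p∪⁅x⁆∣ C v∉C)
                         (maximal (C ∪ ⁅ v ⁆) (IsClique-∪⁅⁆ clique v~C)))
    where
    v∉C : v ∉ C
    v∉C v∈C = proj₁ (v~C v v∈C) refl

  -- The rows, relative to v, that a region vertex occupies in column j − 1 and in
  -- column j; the flag c is the choice of A (false: B^{*+}_{i,j-1} ∪ B^{+*}_{i,j}).
  RowsLeft : Bool → Fin n → Fin n → Set
  RowsLeft c v x = row v < row x ⊎ (row x ≡ row v × s₂ x ≡ true × c ≡ false)

  RowsMid : Bool → Fin n → Fin n → Set
  RowsMid c v y = row y < row v ⊎ (row y ≡ row v × (c ≡ true ⊎ s₁ y ≡ true))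

  Region-split : ∀ {c v x} → Region B c v x →
                 (suc (col x) ≡ col v × RowsLeft c v x) ⊎ (col x ≡ col v × RowsMid c v x)
  Region-split (_ , inj₁ (col≡ , below)) = inj₁ (col≡ , inj₁ below)
  Region-split (_ , inj₂ (inj₁ (col≡ , above))) = inj₂ (col≡ , inj₁ above)
  Region-split {false} (_ , inj₂ (inj₂ (inj₁ (col≡ , row≡ , s₂≡)))) =
    inj₁ (col≡ , inj₂ (row≡ , s₂≡ , refl))
  Region-split {false} (_ , inj₂ (inj₂ (inj₂ (col≡ , row≡ , s₁≡)))) =
    inj₂ (col≡ , inj₂ (row≡ , inj₂ s₁≡))
  Region-split {true} (_ , inj₂ (inj₂ (col≡ , row≡))) =
    inj₂ (col≡ , inj₂ (row≡ , inj₁ refl))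

  RowsLeft-RowsMid : ∀ {c v x y} → RowsLeft c v x → RowsMid c v y →
                     row y < row x ⊎ (row x ≡ row y × s₂ x ≡ true × s₁ y ≡ true)
  RowsLeft-RowsMid (inj₁ v<x) (inj₁ y<v) = inj₁ (<-trans y<v v<x)
  RowsLeft-RowsMid {x = x} (inj₁ v<x) (inj₂ (y≡v , _)) = inj₁ (subst (_< row x) (sym y≡v) v<x)
  RowsLeft-RowsMid {y = y} (inj₂ (x≡v , _)) (inj₁ y<v) = inj₁ (subst (row y <_) (sym x≡v) y<v)
  RowsLeft-RowsMid (inj₂ (_ , _ , refl)) (inj₂ (_ , inj₁ ()))
  RowsLeft-RowsMid (inj₂ (x≡v , s₂≡ , refl)) (inj₂ (y≡v , inj₂ s₁≡)) =
    inj₂ (trans x≡v (sym y≡v) , s₂≡ , s₁≡)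

  AdjRule-nextColumn : ∀ {u w} → suc (col u) ≡ col w →
                       row w < row u ⊎ (row u ≡ row w × s₂ u ≡ true × s₁ w ≡ true) →
                       AdjRule B u w
  AdjRule-nextColumn col≡ (inj₁ w<u) = inj₂ (inj₁ (col≡ , w<u))
  AdjRule-nextColumn col≡ (inj₂ (row≡ , s₂≡ , s₁≡)) = inj₂ (inj₂ (col≡ , row≡ , s₂≡ , s₁≡))

  Region-pairwiseAdj : ∀ {c v x y} → Region B c v x → Region B c v y → x ≢ y → Adj B x y
  Region-pairwiseAdj rx ry x≢y with Region-split rx | Region-split ry
  ... | inj₁ (cx , _) | inj₁ (cy , _) = x≢y , inj₁ (inj₁ (suc-injective (trans cx (sym cy))))
  ... | inj₂ (cx , _) | inj₂ (cy , _) = x≢y , inj₁ (inj₁ (trans cx (sym cy)))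
  ... | inj₁ (cx , lx) | inj₂ (cy , my) =
    x≢y , inj₁ (AdjRule-nextColumn (trans cx (sym cy)) (RowsLeft-RowsMid lx my))
  ... | inj₂ (cx , mx) | inj₁ (cy , ly) =
    x≢y , inj₂ (AdjRule-nextColumn (trans cy (sym cx)) (RowsLeft-RowsMid ly mx))

  groupCount≤ω∸1 : ∀ {c v g w} → IsGroupCount B (Region B c v) g → IsCliqueNumber B w →
                   g ≤ w ∸ 1
  groupCount≤ω∸1 ((R , R⊆region , _ , refl) , _) =
    cliqueInNeighbourhood-∣∣≤ω∸1
      (λ x y x∈R y∈R → Region-pairwiseAdj (R⊆region x x∈R) (R⊆region y y∈R))
      (λ x x∈R → proj₁ (R⊆region x x∈R))

  vertexGroupNumber≤ω∸1 : ∀ {v g w} → IsVertexGroupNumber B v g → IsCliqueNumber B w →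
                          g ≤ w ∸ 1
  vertexGroupNumber≤ω∸1 (_ , _ , count₁ , count₂ , refl) ω =
    ⊔-lub (groupCount≤ω∸1 count₁ ω) (groupCount≤ω∸1 count₂ ω)

lemma27 : (n : ℕ) → 1 ≤ n → (B : BubbleStructure n) → IsUBubbleModel B →
    (φ w : ℕ) → IsGroupNumber B φ → IsCliqueNumber B w → φ ≤ w ∸ 1
lemma27 _ _ B _ _ _ ((_ , gv) , _) ω = vertexGroupNumber≤ω∸1 B gv ω
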